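{- Let $\Gamma=(\mathcal{P},\mathcal{B},\mathbf{I})$ be a generalized quadrangle of order $(s,k)$, where $s$ is an infinite cardinal and $k$ is a finite positive integer (so every line is incident with $s+1$ points and every point is incident with exactly $k+1$ lines). Let $(S,\leq)$ be a totally ordered set. Then $\Gamma$ does not contain an ovoid $\mathcal{O}=\{x_\sigma \mid \sigma\in S\}$ (with $\sigma\mapsto x_\sigma$ injective) that is indiscernible over $(S,\leq)$.
   Context: A generalized quadrangle is a point-line incidence geometry $\Gamma=(\mathcal{P},\mathcal{B},\mathbf{I})$ such that: (i) $\Gamma$ contains no ordinary $k$-gon as a subgeometry for $2\le k<4$; (ii) any two elements of $\mathcal{P}\cup\mathcal{B}$ are contained in some ordinary $4$-gon; (iii) $\Gamma$ contains an ordinary $5$-gon (so in particular every line has at least three points and every point is on at least three lines). Such a geometry has an order $(s,t)$: each line carries $s+1$ points and each point lies on $t+1$ lines. An automorphism of $\Gamma$ is a bijection of $\mathcal{P}\cup\mathcal{B}$ preserving $\mathcal{P}$, $\mathcal{B}$ and incidence. An ovoid is a set $\mathcal{O}$ of points, no two of which are collinear, such that every line of $\Gamma$ is incident with a point of $\mathcal{O}$. A point set $\{x_\sigma\mid \sigma\in S\}$ is indiscernible over the totally ordered set $(S,\leq)$ if for every $n$ and any $\sigma_1<\dots<\sigma_n$ and $\sigma_1'<\dots<\sigma_n'$ in $S$ there is an automorphism of $\Gamma$ mapping $x_{\sigma_i}$ to $x_{\sigma_i'}$ for each $i$. -}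

module Defs where

open import Data.Nat using (ℕ; zero; suc)
open import Data.Nat.DivMod using (_mod_)
open import Data.Fin using (Fin; toℕ)
import Data.Fin as F
open import Data.Sum using (_⊎_; inj₁; inj₂)
open import Data.Product using (Σ; ∃; _×_; _,_; ∃-syntax)
open import Data.Maybe using (Maybe)
open import Relation.Nullary using (¬_)
open import Relation.Binary.PropositionalEquality using (_≡_)
open import Relation.Binary.Structures using (IsTotalOrder)
open import Function.Bundles using (_↔_; _↣_; _⇔_; Inverse)
open import Function.Definitions using (Injective)

next : ∀ {m} → Fin (suc m) → Fin (suc m)
next {m} i = suc (toℕ i) mod (suc m)

-- A point-line incidence geometry (P, B, I); incidence is proof-irrelevant
-- (a relation, not structure).
record IncidenceGeometry : Set₁ where
  field
    P : Set
    B : Set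
    I : P → B → Set
    I-prop : ∀ {x L} (a b : I x L) → a ≡ b

module _ (Γ : IncidenceGeometry) where
  open IncidenceGeometry Γ

  -- An ordinary (m+1)-gon: points p 0..m, lines l 0..m, pairwise distinct,
  -- with p i I l i and p (i+1) I l i (indices mod m+1).
  record OrdinaryGon (m : ℕ) : Set where
    field
      pt  : Fin (suc m) → P
      ln  : Fin (suc m) → B
      pt-inj : Injective _≡_ _≡_ pt
      ln-inj : Injective _≡_ _≡_ ln
      inc₁ : ∀ i → I (pt i) (ln i)
      inc₂ : ∀ i → I (pt (next i)) (ln i)

  OnGon : ∀ {m} → OrdinaryGon m → P ⊎ B → Set
  OnGon g e = (∃[ i ] e ≡ inj₁ (OrdinaryGon.pt g i)) ⊎ (∃[ i ] e ≡ inj₂ (OrdinaryGon.ln g i))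

  record IsGQ : Set where
    field
      no-2-gon : ¬ OrdinaryGon 1
      no-3-gon : ¬ OrdinaryGon 2
      in-4-gon : ∀ (e e' : P ⊎ B) → Σ (OrdinaryGon 3) λ g → OnGon g e × OnGon g e'
      has-5-gon : OrdinaryGon 4

  PointsOn : B → Set
  PointsOn L = Σ P λ x → I x L

  LinesThrough : P → Set
  LinesThrough x = Σ B λ L → I x L

  -- Γ has order (s,k) where s = |Sc| is an infinite cardinal and k is finite:
  -- every line carries s+1 (= |Maybe Sc|) points, every point is on k+1 lines.
  record HasOrderInfFin (Sc : Set) (k : ℕ) : Set where
    field
      s-infinite : ℕ ↣ Sc
      line-size  : ∀ L → PointsOn L ↔ Maybe Sc
      point-deg  : ∀ x → LinesThrough x ↔ Fin (suc k)

  Collinear : P → P → Set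
  Collinear x y = ∃[ L ] (I x L × I y L)

  IsOvoid : {S : Set} → (S → P) → Set
  IsOvoid {S} x =
    (∀ σ τ → ¬ x σ ≡ x τ → ¬ Collinear (x σ) (x τ)) ×
    (∀ L → ∃[ σ ] I (x σ) L)

  record Automorphism : Set where
    field
      onP : P ↔ P
      onB : B ↔ B
      preserves : ∀ x L → I x L ⇔ I (Inverse.to onP x) (Inverse.to onB L)

  module _ {S : Set} (_≤_ : S → S → Set) where
    _<ₛ_ : S → S → Set
    a <ₛ b = a ≤ b × ¬ a ≡ b

    StrictlyIncreasing : ∀ {n} → (Fin n → S) → Set
    StrictlyIncreasing {n} σ = ∀ (i j : Fin n) → i F.< j → σ i <ₛ σ j

    Indiscernible : (S → P) → Set
    Indiscernible x = ∀ (n : ℕ) (σ σ' : Fin n → S) →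
      StrictlyIncreasing σ → StrictlyIncreasing σ' →
      Σ Automorphism λ φ → ∀ i → Inverse.to (Automorphism.onP φ) (x (σ i)) ≡ x (σ' i)

-- If every point is on just two lines, a vertex of an ordinary pentagon is joined to the
-- opposite side along one of its two pentagon sides, which closes a triangle; so every point
-- is on at least three lines. Indiscernibility over a total order then makes "three ovoid
-- points have a common collinear point" hold for every triple once it holds for one, and it
-- does hold for the ovoid points on three lines through a point off the ovoid. Fix ovoid
-- points y, y'. A point z collinear with both is determined by the line yz, as a point off
-- a line is collinear with at most one of its points, and every further ovoid point is
-- joined to its z by one of the k+1 lines through z; so among (k+1)²+1 further ovoid points
-- two are collinear. But the ovoid is infinite: the infinitely many points off the ovoid on
-- a line are collinear with pairwise distinct ovoid points off that line.

module Submission where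

open import Defs
open import Data.Empty using (⊥)
open import Data.Fin using (Fin; toℕ; combine; _↑ˡ_; punchIn)
  renaming (_<_ to _<ᶠ_; _≟_ to _≟ᶠ_)
open import Data.Fin.Patterns using (0F; 1F; 2F; 3F; 4F)
open import Data.Fin.Permutation
  using (Permutation′; _⟨$⟩ʳ_; _⟨$⟩ˡ_; inverseʳ; id; transpose; _∘ₚ_)
open import Data.Fin.Properties
  using (pigeonhole; combine-injective; toℕ-injective; ↑ˡ-injective; punchInᵢ≢i; <⇒≢)
open import Data.Maybe using (just)
open import Data.Maybe.Properties using (just-injective)
open import Data.Nat using (ℕ; zero; suc; _+_; _*_; _<_; s≤s)
open import Data.Nat.Properties using (n<1+n; +-cancelˡ-≡; m≢1+m+n) renaming (_≟_ to _≟ℕ_)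
open import Data.Product using (Σ; ∃; _×_; _,_; proj₁; proj₂)
open import Data.Sum using (inj₁; inj₂)
open import Data.Vec.Functional using ([]; _∷_)
open import Function using (_∘_)
open import Function.Bundles using (_↔_; Inverse; Injection; Equivalence)
open import Function.Definitions using (Injective)
open import Function.Properties.Inverse using (↔⇒↣; ↔-sym)
open import Relation.Binary.PropositionalEquality
  using (_≡_; _≢_; refl; sym; trans; cong; subst)
open import Relation.Binary.Structures using (IsTotalOrder)
open import Relation.Nullary using (¬_; yes; no; ¬¬-excluded-middle)
open import Relation.Nullary.Decidable using (decidable-stable)
open import Relation.Nullary.Negation using (contradiction; ¬¬-map)

pair-injective : {A : Set} {u v : A} → u ≢ v → Injective _≡_ _≡_ (u ∷ v ∷ [])
pair-injective u≢v {0F} {0F} _ = refl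
pair-injective u≢v {0F} {1F} e = contradiction e u≢v
pair-injective u≢v {1F} {0F} e = contradiction (sym e) u≢v
pair-injective u≢v {1F} {1F} _ = refl

triple-injective : {A : Set} {u v w : A} → u ≢ v → u ≢ w → v ≢ w →
  Injective _≡_ _≡_ (u ∷ v ∷ w ∷ [])
triple-injective u≢v u≢w v≢w {0F} {0F} _ = refl
triple-injective u≢v u≢w v≢w {0F} {1F} e = contradiction e u≢v
triple-injective u≢v u≢w v≢w {0F} {2F} e = contradiction e u≢w
triple-injective u≢v u≢w v≢w {1F} {0F} e = contradiction (sym e) u≢v
triple-injective u≢v u≢w v≢w {1F} {1F} _ = refl
triple-injective u≢v u≢w v≢w {1F} {2F} e = contradiction e v≢w
triple-injective u≢v u≢w v≢w {2F} {0F} e = contradiction (sym e) u≢w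
triple-injective u≢v u≢w v≢w {2F} {1F} e = contradiction (sym e) v≢w
triple-injective u≢v u≢w v≢w {2F} {2F} _ = refl

to-injective : {A C : Set} (e : A ↔ C) → Injective _≡_ _≡_ (Inverse.to e)
to-injective e = Injection.injective (↔⇒↣ e)

from-injective : {A C : Set} (e : A ↔ C) → Injective _≡_ _≡_ (Inverse.from e)
from-injective e = to-injective (↔-sym e)

injective-avoids : {A : Set} (f : ℕ → A) → Injective _≡_ _≡_ f → (a : A) →
  ¬ ¬ (Σ ℕ λ m → ∀ n → f (m + n) ≢ a)
injective-avoids f f-inj a k = ¬¬-excluded-middle {A = Σ ℕ λ m → f m ≡ a} λ where
  (yes (m , fm≡a)) → k (suc m , λ n e → m≢1+m+n m (f-inj (trans fm≡a (sym e))))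
  (no ¬hit) → k (0 , λ n e → ¬hit (n , e))

module Incidence (Γ : IncidenceGeometry) where
  open IncidenceGeometry Γ

  pointOn-≡ : ∀ {L} {u v : PointsOn Γ L} → proj₁ u ≡ proj₁ v → u ≡ v
  pointOn-≡ {u = p , _} {v = .p , _} refl = cong (p ,_) (I-prop _ _)

  lineThrough-≡ : ∀ {p} {u v : LinesThrough Γ p} → proj₁ u ≡ proj₁ v → u ≡ v
  lineThrough-≡ {u = L , _} {v = .L , _} refl = cong (L ,_) (I-prop _ _)

  CommonNeighbour : {A : Set} → (A → P) → Set
  CommonNeighbour y = Σ P λ z → ∀ a → Collinear Γ z (y a)

  commonNeighbour-reindex : {A C : Set} {y : A → P} (f : C → A) →
    CommonNeighbour y → CommonNeighbour (y ∘ f)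
  commonNeighbour-reindex f (z , z~y) = z , z~y ∘ f

  commonNeighbour-permute : ∀ {n} {y : Fin n → P} (π : Permutation′ n) →
    CommonNeighbour (y ∘ (π ⟨$⟩ʳ_)) → CommonNeighbour y
  commonNeighbour-permute {y = y} π (z , z~y) =
    z , λ i → subst (Collinear Γ z ∘ y) (inverseʳ π) (z~y (π ⟨$⟩ˡ i))

  commonNeighbour-automorphism : {A : Set} {y y' : A → P} (φ : Automorphism Γ) →
    (∀ a → Inverse.to (Automorphism.onP φ) (y a) ≡ y' a) →
    CommonNeighbour y → CommonNeighbour y'
  commonNeighbour-automorphism φ φy≡y' (z , z~y) =
    φP z , λ a → subst (Collinear Γ (φP z)) (φy≡y' a) (collinear-image (z~y a))
    where
    open Automorphism φ
    φP : P → P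
    φP = Inverse.to onP
    collinear-image : ∀ {p q} → Collinear Γ p q → Collinear Γ (φP p) (φP q)
    collinear-image {p} {q} (L , pL , qL) =
      Inverse.to onB L , Equivalence.to (preserves p L) pL , Equivalence.to (preserves q L) qL

  module _ {S : Set} {_≤_ : S → S → Set} (tot : IsTotalOrder _≡_ _≤_) where
    open IsTotalOrder tot using (total) renaming (trans to ≤-trans)

    increasing3 : {τ : Fin 3 → S} → Injective _≡_ _≡_ τ →
      τ 0F ≤ τ 1F → τ 1F ≤ τ 2F → StrictlyIncreasing Γ _≤_ τ
    increasing3 τ-inj τ₀≤τ₁ τ₁≤τ₂ = λ where
      0F 1F _ → τ₀≤τ₁ , (λ ()) ∘ τ-inj
      0F 2F _ → ≤-trans τ₀≤τ₁ τ₁≤τ₂ , (λ ()) ∘ τ-inj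
      1F 2F _ → τ₁≤τ₂ , (λ ()) ∘ τ-inj
      0F 0F ()
      1F 0F ()
      1F 1F (s≤s ())
      2F 0F ()
      2F 1F (s≤s ())
      2F 2F (s≤s (s≤s ()))

    Sorting : ∀ {n} → (Fin n → S) → Set
    Sorting {n} ρ = Σ (Permutation′ n) λ π → StrictlyIncreasing Γ _≤_ (ρ ∘ (π ⟨$⟩ʳ_))

    sorted-by : {ρ : Fin 3 → S} → Injective _≡_ _≡_ ρ → (π : Permutation′ 3) →
      ρ (π ⟨$⟩ʳ 0F) ≤ ρ (π ⟨$⟩ʳ 1F) → ρ (π ⟨$⟩ʳ 1F) ≤ ρ (π ⟨$⟩ʳ 2F) → Sorting ρ
    sorted-by ρ-inj π ≤₀₁ ≤₁₂ = π , increasing3 (to-injective π ∘ ρ-inj) ≤₀₁ ≤₁₂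

    sort3 : (ρ : Fin 3 → S) → Injective _≡_ _≡_ ρ → Sorting ρ
    sort3 ρ ρ-inj with total (ρ 0F) (ρ 1F) | total (ρ 1F) (ρ 2F) | total (ρ 0F) (ρ 2F)
    ... | inj₁ ρ₀≤ρ₁ | inj₁ ρ₁≤ρ₂ | _          = sorted-by ρ-inj id ρ₀≤ρ₁ ρ₁≤ρ₂
    ... | inj₁ ρ₀≤ρ₁ | inj₂ ρ₂≤ρ₁ | inj₁ ρ₀≤ρ₂ = sorted-by ρ-inj (transpose 1F 2F) ρ₀≤ρ₂ ρ₂≤ρ₁
    ... | inj₁ ρ₀≤ρ₁ | inj₂ ρ₂≤ρ₁ | inj₂ ρ₂≤ρ₀ =
      sorted-by ρ-inj (transpose 1F 2F ∘ₚ transpose 0F 2F) ρ₂≤ρ₀ ρ₀≤ρ₁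
    ... | inj₂ ρ₁≤ρ₀ | inj₁ ρ₁≤ρ₂ | inj₁ ρ₀≤ρ₂ = sorted-by ρ-inj (transpose 0F 1F) ρ₁≤ρ₀ ρ₀≤ρ₂
    ... | inj₂ ρ₁≤ρ₀ | inj₁ ρ₁≤ρ₂ | inj₂ ρ₂≤ρ₀ =
      sorted-by ρ-inj (transpose 0F 1F ∘ₚ transpose 0F 2F) ρ₁≤ρ₂ ρ₂≤ρ₀
    ... | inj₂ ρ₁≤ρ₀ | inj₂ ρ₂≤ρ₁ | _          = sorted-by ρ-inj (transpose 0F 2F) ρ₂≤ρ₁ ρ₁≤ρ₀

    commonNeighbour-transfer : {x : S → P} → Indiscernible Γ _≤_ x →
      {ρ ρ' : Fin 3 → S} → Injective _≡_ _≡_ ρ → Injective _≡_ _≡_ ρ' →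
      CommonNeighbour (x ∘ ρ) → CommonNeighbour (x ∘ ρ')
    commonNeighbour-transfer ind {ρ} {ρ'} ρ-inj ρ'-inj cn
      with sort3 ρ ρ-inj | sort3 ρ' ρ'-inj
    ... | π , ρπ↑ | π' , ρ'π'↑ with ind 3 _ _ ρπ↑ ρ'π'↑
    ... | φ , φx≡x' = commonNeighbour-permute π'
      (commonNeighbour-automorphism φ φx≡x' (commonNeighbour-reindex (π ⟨$⟩ʳ_) cn))

module Degree (Γ : IncidenceGeometry) {n : ℕ} (deg : ∀ x → LinesThrough Γ x ↔ Fin n)
  where
  open IncidenceGeometry Γ
  open Incidence Γ using (lineThrough-≡)

  lineIndex : ∀ {x L} → I x L → Fin n
  lineIndex {x} {L} xL = Inverse.to (deg x) (L , xL)

  lineIndex-injective : ∀ {x x' L L'} → x ≡ x' → (xL : I x L) (x'L' : I x' L') →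
    lineIndex xL ≡ lineIndex x'L' → L ≡ L'
  lineIndex-injective refl xL xL' e = cong proj₁ (to-injective (deg _) e)

  lineAt : P → Fin n → B
  lineAt x i = proj₁ (Inverse.from (deg x) i)

  lineAt-incident : ∀ x i → I x (lineAt x i)
  lineAt-incident x i = proj₂ (Inverse.from (deg x) i)

  lineAt-injective : ∀ x → Injective _≡_ _≡_ (lineAt x)
  lineAt-injective x e = from-injective (deg x) (lineThrough-≡ e)

  lineAt-lineIndex : ∀ {x L} (xL : I x L) → lineAt x (lineIndex xL) ≡ L
  lineAt-lineIndex {x} {L} xL = cong proj₁ (Inverse.strictlyInverseʳ (deg x) (L , xL))

  lines-through-bounded : ∀ {m x} (L : Fin m → B) → (∀ i → I x (L i)) →
    Injective _≡_ _≡_ L → ¬ n < m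
  lines-through-bounded L xL L-inj n<m with pigeonhole n<m (λ i → lineIndex (xL i))
  ... | i , j , i<j , e = <⇒≢ i<j (L-inj (lineIndex-injective refl (xL i) (xL j) e))

module Quadrangle (Γ : IncidenceGeometry) (gq : IsGQ Γ) where
  open IncidenceGeometry Γ
  open IsGQ gq

  no-digon : ∀ {p q L M} → p ≢ q → L ≢ M → I p L → I q L → I q M → I p M → ⊥
  no-digon p≢q L≢M pL qL qM pM = no-2-gon record
    { pt = _ ∷ _ ∷ [] ; ln = _ ∷ _ ∷ []
    ; pt-inj = pair-injective p≢q ; ln-inj = pair-injective L≢M
    ; inc₁ = λ { 0F → pL ; 1F → qM }
    ; inc₂ = λ { 0F → qL ; 1F → pM } }

  no-triangle : ∀ {p q r L M N} → p ≢ q → p ≢ r → q ≢ r → L ≢ M → L ≢ N → M ≢ N →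
    I p L → I q L → I q M → I r M → I r N → I p N → ⊥
  no-triangle p≢q p≢r q≢r L≢M L≢N M≢N pL qL qM rM rN pN = no-3-gon record
    { pt = _ ∷ _ ∷ _ ∷ [] ; ln = _ ∷ _ ∷ _ ∷ []
    ; pt-inj = triple-injective p≢q p≢r q≢r ; ln-inj = triple-injective L≢M L≢N M≢N
    ; inc₁ = λ { 0F → pL ; 1F → qM ; 2F → rN }
    ; inc₂ = λ { 0F → qL ; 1F → rM ; 2F → pN } }

  quadrangle-projection : (g : OrdinaryGon Γ 3) → ∀ i j →
    let open OrdinaryGon g in
    ¬ I (pt i) (ln j) → Σ P λ q → I q (ln j) × Collinear Γ q (pt i)
  quadrangle-projection g = λ where
      0F 0F ∉ → contradiction (inc₁ 0F) ∉
      0F 1F _ → pt 1F , inc₁ 1F , ln 0F , inc₂ 0F , inc₁ 0F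
      0F 2F _ → pt 3F , inc₂ 2F , ln 3F , inc₁ 3F , inc₂ 3F
      0F 3F ∉ → contradiction (inc₂ 3F) ∉
      1F 0F ∉ → contradiction (inc₂ 0F) ∉
      1F 1F ∉ → contradiction (inc₁ 1F) ∉
      1F 2F _ → pt 2F , inc₁ 2F , ln 1F , inc₂ 1F , inc₁ 1F
      1F 3F _ → pt 0F , inc₂ 3F , ln 0F , inc₁ 0F , inc₂ 0F
      2F 0F _ → pt 1F , inc₂ 0F , ln 1F , inc₁ 1F , inc₂ 1F
      2F 1F ∉ → contradiction (inc₂ 1F) ∉
      2F 2F ∉ → contradiction (inc₁ 2F) ∉
      2F 3F _ → pt 3F , inc₁ 3F , ln 2F , inc₂ 2F , inc₁ 2F
      3F 0F _ → pt 0F , inc₁ 0F , ln 3F , inc₂ 3F , inc₁ 3F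
      3F 1F _ → pt 2F , inc₂ 1F , ln 2F , inc₁ 2F , inc₂ 2F
      3F 2F ∉ → contradiction (inc₂ 2F) ∉
      3F 3F ∉ → contradiction (inc₁ 3F) ∉
    where open OrdinaryGon g

  collinear-point-on-line : ∀ {p L} → ¬ I p L → Σ P λ q → I q L × Collinear Γ q p
  collinear-point-on-line {p} {L} p∉L with in-4-gon (inj₁ p) (inj₂ L)
  ... | g , inj₁ (i , refl) , inj₂ (j , refl) = quadrangle-projection g i j p∉L
  ... | g , inj₂ (_ , ()) , _
  ... | g , _ , inj₁ (_ , ())

  collinear-on-line-unique : ∀ {y z z' Λ} → I z Λ → I z' Λ → ¬ I y Λ →
    Collinear Γ z y → Collinear Γ z' y → ¬ z ≢ z'
  collinear-on-line-unique {y} {Λ = Λ} zΛ z'Λ y∉Λ (N , zN , yN) (N' , z'N' , yN') z≢z' =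
    no-triangle z≢z' (off-Λ zΛ) (off-Λ z'Λ) (Λ-avoids yN') (Λ-avoids yN) N'≢N
      zΛ z'Λ z'N' yN' yN zN
    where
    off-Λ : ∀ {u} → I u Λ → u ≢ y
    off-Λ uΛ refl = y∉Λ uΛ
    Λ-avoids : ∀ {M} → I y M → Λ ≢ M
    Λ-avoids yM refl = y∉Λ yM
    N'≢N : N' ≢ N
    N'≢N refl = no-digon z≢z' (Λ-avoids yN) zΛ z'Λ z'N' zN

  module _ {n : ℕ} (deg : ∀ x → LinesThrough Γ x ↔ Fin n) where
    open Degree Γ deg

    collinear-pair-near-trace : ∀ {y y'} → ¬ Collinear Γ y y' →
      (z w : Fin (suc (n * n)) → P) →
      (∀ i → Collinear Γ (z i) y) → (∀ i → Collinear Γ (z i) y') →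
      (∀ i → Collinear Γ (z i) (w i)) →
      ¬ (∀ {i j} → i <ᶠ j → ¬ Collinear Γ (w i) (w j))
    collinear-pair-near-trace {y} {y'} y≁y' z w z~y z~y' z~w w-noncollinear =
      collide (pigeonhole (n<1+n (n * n)) index)
      where
      lineIndex₂ : ∀ {p q} → Collinear Γ p q → Fin n
      lineIndex₂ (_ , _ , qL) = lineIndex qL
      lineIndex₁ : ∀ {p q} → Collinear Γ p q → Fin n
      lineIndex₁ (_ , pL , _) = lineIndex pL
      index : Fin (suc (n * n)) → Fin (n * n)
      index i = combine (lineIndex₂ (z~y i)) (lineIndex₁ (z~w i))
      collide : (∃ λ i → ∃ λ j → i <ᶠ j × index i ≡ index j) → ⊥
      collide (i , j , i<j , e) =
        same-indices (z~y i) (z~y j) (z~w i) (z~w j) (combine-injective _ _ _ _ e)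
        where
        same-indices : (ci : Collinear Γ (z i) y) (cj : Collinear Γ (z j) y)
          (di : Collinear Γ (z i) (w i)) (dj : Collinear Γ (z j) (w j)) →
          lineIndex₂ ci ≡ lineIndex₂ cj × lineIndex₁ di ≡ lineIndex₁ dj → ⊥
        same-indices (Λ , ziΛ , yΛ) (Λ' , zjΛ' , yΛ') (M , ziM , wiM) (M' , zjM' , wjM')
          (eΛ , eM) =
          collinear-on-line-unique ziΛ (subst (I (z j)) (sym Λ≡Λ') zjΛ') y'∉Λ
            (z~y' i) (z~y' j)
            λ zi≡zj → w-noncollinear i<j
              (M , wiM , subst (I (w j)) (sym (lineIndex-injective zi≡zj ziM zjM' eM)) wjM')
          where
          Λ≡Λ' : Λ ≡ Λ'
          Λ≡Λ' = lineIndex-injective refl yΛ yΛ' eΛ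
          y'∉Λ : ¬ I y' Λ
          y'∉Λ y'Λ = y≁y' (Λ , yΛ , y'Λ)

module DegreeTwo (Γ : IncidenceGeometry) (gq : IsGQ Γ)
  (deg : ∀ x → LinesThrough Γ x ↔ Fin 2) where
  open IncidenceGeometry Γ
  open IsGQ gq
  open Quadrangle Γ gq
  open Degree Γ deg

  three-lines-through : ∀ {x L M N} → L ≢ M → L ≢ N → M ≢ N → I x L → I x M → I x N → ⊥
  three-lines-through L≢M L≢N M≢N xL xM xN =
    lines-through-bounded (_ ∷ _ ∷ _ ∷ []) (λ { 0F → xL ; 1F → xM ; 2F → xN })
      (triple-injective L≢M L≢N M≢N) (n<1+n 2)

  no-trilateral : ∀ {p q r L M N} → L ≢ M → L ≢ N → M ≢ N →
    I p L → I q L → I q M → I r M → I r N → I p N → ⊥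
  no-trilateral {p} {q} {r} L≢M L≢N M≢N pL qL qM rM rN pN =
    no-triangle p≢q p≢r q≢r L≢M L≢N M≢N pL qL qM rM rN pN
    where
    p≢q : p ≢ q
    p≢q refl = three-lines-through L≢M L≢N M≢N pL qM pN
    p≢r : p ≢ r
    p≢r refl = three-lines-through L≢M L≢N M≢N pL rM pN
    q≢r : q ≢ r
    q≢r refl = three-lines-through L≢M L≢N M≢N qL qM rN

  point-degree-two-impossible : ⊥
  point-degree-two-impossible = from-projection (collinear-point-on-line p₀∉l₂)
    where
    open OrdinaryGon has-5-gon
    l≢ : ∀ {i j} → i ≢ j → ln i ≢ ln j
    l≢ i≢j = i≢j ∘ ln-inj
    p₀∉l₂ : ¬ I (pt 0F) (ln 2F)
    p₀∉l₂ p₀l₂ =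
      three-lines-through (l≢ λ ()) (l≢ λ ()) (l≢ λ ()) (inc₁ 0F) p₀l₂ (inc₂ 4F)
    from-projection : (Σ P λ q → I q (ln 2F) × Collinear Γ q (pt 0F)) → ⊥
    from-projection (q , ql₂ , M , qM , p₀M) =
      three-lines-through M≢l₀ M≢l₄ (l≢ λ ()) p₀M (inc₁ 0F) (inc₂ 4F)
      where
      M≢l₀ : M ≢ ln 0F
      M≢l₀ refl = no-trilateral (l≢ λ ()) (l≢ λ ()) (l≢ λ ())
        qM (inc₂ 0F) (inc₁ 1F) (inc₂ 1F) (inc₁ 2F) ql₂
      M≢l₄ : M ≢ ln 4F
      M≢l₄ refl = no-trilateral (l≢ λ ()) (l≢ λ ()) (l≢ λ ())
        ql₂ (inc₂ 2F) (inc₁ 3F) (inc₂ 3F) (inc₁ 4F) qM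

module LinePoints (Γ : IncidenceGeometry) {Sc : Set} {k : ℕ} (ord : HasOrderInfFin Γ Sc k)
  where
  open IncidenceGeometry Γ
  open HasOrderInfFin ord
  open Incidence Γ using (pointOn-≡)

  linePoint : B → ℕ → P
  linePoint L n = proj₁ (Inverse.from (line-size L) (just (Injection.to s-infinite n)))

  linePoint-incident : ∀ L n → I (linePoint L n) L
  linePoint-incident L n =
    proj₂ (Inverse.from (line-size L) (just (Injection.to s-infinite n)))

  linePoint-injective : ∀ L → Injective _≡_ _≡_ (linePoint L)
  linePoint-injective L e = Injection.injective s-infinite
    (just-injective (from-injective (line-size L) (pointOn-≡ e)))

module Ovoid (Γ : IncidenceGeometry) (gq : IsGQ Γ) {Sc : Set} {k : ℕ}
  (ord : HasOrderInfFin Γ Sc (suc (suc k)))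
  {S : Set} (x : S → IncidenceGeometry.P Γ) (x-inj : Injective _≡_ _≡_ x)
  (ovoid : IsOvoid Γ x) where
  open IncidenceGeometry Γ
  open IsGQ gq
  open HasOrderInfFin ord
  open Incidence Γ
  open Quadrangle Γ gq
  open Degree Γ point-deg
  open LinePoints Γ ord

  ovoidPoint : B → S
  ovoidPoint L = proj₁ (proj₂ ovoid L)

  ovoidPoint-incident : ∀ L → I (x (ovoidPoint L)) L
  ovoidPoint-incident L = proj₂ (proj₂ ovoid L)

  ovoid-noncollinear : ∀ {σ τ} → σ ≢ τ → ¬ Collinear Γ (x σ) (x τ)
  ovoid-noncollinear σ≢τ = proj₁ ovoid _ _ (σ≢τ ∘ x-inj)

  off-ovoid : ∀ {L a p} → I (x a) L → I p L → p ≢ x a → ∀ σ → x σ ≢ p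
  off-ovoid {L} aL pL p≢xa σ refl = ovoid-noncollinear (p≢xa ∘ cong x) (L , pL , aL)

  PointsOffOvoid : B → Set
  PointsOffOvoid L =
    Σ (ℕ → P) λ p → Injective _≡_ _≡_ p × (∀ n → I (p n) L) × (∀ n σ → x σ ≢ p n)

  -- Whether the ovoid point of L is among the linePoints of L is undecidable.
  ¬¬-points-off-ovoid : ∀ L → ¬ ¬ PointsOffOvoid L
  ¬¬-points-off-ovoid L =
    ¬¬-map tail (injective-avoids (linePoint L) (linePoint-injective L) (x a))
    where
    a : S
    a = ovoidPoint L
    tail : (Σ ℕ λ m → ∀ n → linePoint L (m + n) ≢ x a) → PointsOffOvoid L
    tail (m , avoids) =
      linePoint L ∘ (m +_) , (λ e → +-cancelˡ-≡ m _ _ (linePoint-injective L e)) ,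
      linePoint-incident L ∘ (m +_) ,
      λ n → off-ovoid (ovoidPoint-incident L) (linePoint-incident L (m + n)) (avoids n)

  line-other-than : ∀ {p L} → I p L → Σ B λ M → I p M × M ≢ L
  line-other-than {p} pL = lineAt p j , lineAt-incident p j ,
    λ M≡L → punchInᵢ≢i _ _ (lineAt-injective p (trans M≡L (sym (lineAt-lineIndex pL))))
    where
    j = punchIn (lineIndex pL) 0F

  ovoid-point-off-line : ∀ {p L} → I p L → (∀ σ → x σ ≢ p) →
    Σ S λ σ → Collinear Γ p (x σ) × ¬ I (x σ) L
  ovoid-point-off-line pL p∉O with line-other-than pL
  ... | M , pM , M≢L = ovoidPoint M , (M , pM , ovoidPoint-incident M) ,
    no-digon (p∉O _) M≢L (ovoidPoint-incident M) pM pL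

  ovoid-infinite : ∀ {L} → PointsOffOvoid L → Σ (ℕ → S) (Injective _≡_ _≡_)
  ovoid-infinite {L} (p , p-inj , p-on , p∉O) = far , far-injective
    where
    near : ∀ n → Σ S λ σ → Collinear Γ (p n) (x σ) × ¬ I (x σ) L
    near n = ovoid-point-off-line (p-on n) (p∉O n)
    far : ℕ → S
    far = proj₁ ∘ near
    far-injective : Injective _≡_ _≡_ far
    far-injective {m} {n} e = decidable-stable (m ≟ℕ n) λ m≢n →
      collinear-on-line-unique (p-on m) (p-on n)
        (proj₂ (proj₂ (near m))) (proj₁ (proj₂ (near m)))
        (subst (Collinear Γ (p n) ∘ x) (sym e) (proj₁ (proj₂ (near n))))
        (m≢n ∘ p-inj)

  ovoid-neighbours : ∀ {p} → (∀ σ → x σ ≢ p) →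
    Σ (Fin (3 + k) → S) λ ρ → Injective _≡_ _≡_ ρ × CommonNeighbour (x ∘ ρ)
  ovoid-neighbours {p} p∉O =
    ρ , ρ-inj , p , λ i → lineAt p i , lineAt-incident p i , ovoidPoint-incident (lineAt p i)
    where
    ρ : Fin (3 + k) → S
    ρ = ovoidPoint ∘ lineAt p
    ρ-inj : Injective _≡_ _≡_ ρ
    ρ-inj {i} {j} e = decidable-stable (i ≟ᶠ j) λ i≢j →
      no-digon (p∉O (ρ i)) (i≢j ∘ lineAt-injective p) (ovoidPoint-incident _)
        (lineAt-incident p i) (lineAt-incident p j)
        (subst (λ σ → I (x σ) (lineAt p j)) (sym e) (ovoidPoint-incident _))

  no-indiscernible-ovoid : {_≤_ : S → S → Set} → IsTotalOrder _≡_ _≤_ →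
    Indiscernible Γ _≤_ x → ⊥
  no-indiscernible-ovoid tot ind =
    ¬¬-points-off-ovoid (OrdinaryGon.ln has-5-gon 0F) λ { off@(_ , _ , _ , p∉O) →
      contradict (ovoid-infinite off) (ovoid-neighbours (p∉O 0)) }
    where
    N : ℕ
    N = suc ((3 + k) * (3 + k))
    contradict : Σ (ℕ → S) (Injective _≡_ _≡_) →
      Σ (Fin (3 + k) → S) (λ ρ → Injective _≡_ _≡_ ρ × CommonNeighbour (x ∘ ρ)) → ⊥
    contradict (c , c-inj) (ρ , ρ-inj , ρ-cn) =
      collinear-pair-near-trace point-deg (ovoid-noncollinear (c≢ λ ())) z (x ∘ d)
        (λ i → proj₂ (cn i) 0F) (λ i → proj₂ (cn i) 1F) (λ i → proj₂ (cn i) 2F)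
        (λ i<j → ovoid-noncollinear (c≢ (<⇒≢ i<j ∘ toℕ-injective ∘ +-cancelˡ-≡ 2 _ _)))
      where
      c≢ : ∀ {m n} → m ≢ n → c m ≢ c n
      c≢ m≢n = m≢n ∘ c-inj
      d : Fin N → S
      d i = c (2 + toℕ i)
      cn : ∀ i → CommonNeighbour (x ∘ (c 0 ∷ c 1 ∷ d i ∷ []))
      cn i = commonNeighbour-transfer tot {x} ind {ρ' = c 0 ∷ c 1 ∷ d i ∷ []}
        (↑ˡ-injective k _ _ ∘ ρ-inj) (triple-injective (c≢ λ ()) (c≢ λ ()) (c≢ λ ()))
        (commonNeighbour-reindex (_↑ˡ k) ρ-cn)
      z : Fin N → P
      z = proj₁ ∘ cn

mainTheorem1 : (Γ : IncidenceGeometry) → IsGQ Γ →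
    (Sc : Set) (k : ℕ) → 0 < k → HasOrderInfFin Γ Sc k →
    (S : Set) (_≤_ : S → S → Set) → IsTotalOrder _≡_ _≤_ →
    ¬ (Σ (S → IncidenceGeometry.P Γ) λ x →
         Injective _≡_ _≡_ x × IsOvoid Γ x × Indiscernible Γ _≤_ x)
mainTheorem1 _ _ _ zero () _ _ _ _
mainTheorem1 Γ gq _ (suc zero) _ ord _ _ _ _ =
  DegreeTwo.point-degree-two-impossible Γ gq (HasOrderInfFin.point-deg ord)
mainTheorem1 Γ gq _ (suc (suc k)) _ ord _ _ tot (x , x-inj , ovoid , ind) =
  Ovoid.no-indiscernible-ovoid Γ gq ord x x-inj ovoid tot ind
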